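{- Let $H$ be an instance hypergraph of MTRS-minNum (as described in the context) such that $|\Delta|=|R|$ and for every $\eta\in\Delta$ and every $r\in R$, $\{\eta,r\}$ is an edge of $H$, and let $\lambda=\max_{\eta\in\Delta}\lambda_\eta\ge 2$. Let $M$ be the solution output by Algorithm GreedyMinNum and $M^*$ an optimal solution of MTRS-minNum. Then $\frac{|M|}{|M^*|}\le\frac{\lambda+2}{2}$.
   Context: An instance of MTRS-minNum: finite sets $R$ (riders) and $D=\Delta$ (designated drivers), each driver $\eta$ with capacity $\lambda_\eta\ge 1$; a hypergraph $H$ with vertex set $\Delta\cup R$ whose edges (feasible matches) are sets $\{\eta\}\cup S$ with $\eta\in\Delta$, $\emptyset\neq S\subseteq R$, $|S|\le\lambda_\eta$; for $e=\{\eta\}\cup S$ write $D(e)=\eta$, $R(e)=S$. The edge set is closed under nonempty subsets of riders: if $\{\eta\}\cup S$ is an edge with $|S|\ge2$ then $\{\eta\}\cup S'$ is an edge for every nonempty $S'\subseteq S$. A feasible solution is a set of pairwise vertex-disjoint edges covering every rider; an optimal solution is a feasible solution of minimum cardinality. Algorithm GreedyMinNum: start with $M=\emptyset$ and the original $H$; repeatedly select an edge $e$ of the current hypergraph with maximum $|R(e)|$, add it to $M$, and delete all vertices of $e$ and all edges containing a vertex of $e$; stop when every rider is covered by $M$. -}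

module Defs where

open import Data.Nat using (ℕ; _≤_; _*_; _+_)
open import Data.Fin using (Fin)
open import Data.Fin.Subset using (Subset; ∣_∣; _∈_; _⊆_; Nonempty; ⁅_⁆)
open import Data.Product using (_×_; _,_; proj₁; proj₂; Σ)
open import Data.List using (List; []; _∷_; length)
open import Data.List.Relation.Unary.All using (All)
open import Data.List.Relation.Unary.Any using (Any)
open import Data.List.Relation.Unary.AllPairs using (AllPairs)
open import Relation.Binary.PropositionalEquality using (_≢_)
open import Relation.Nullary using (¬_)
open import Data.Empty using (⊥)

-- Drivers Δ = Fin n and riders R = Fin n (so |Δ| = |R| = n).
-- An edge {η} ∪ S is represented by the pair (η , S).
Edge : ℕ → Set
Edge n = Fin n × Subset n

D : ∀ {n} → Edge n → Fin n
D = proj₁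

Rd : ∀ {n} → Edge n → Subset n
Rd = proj₂

Disjoint : ∀ {n} → Subset n → Subset n → Set
Disjoint S T = ∀ r → r ∈ S → r ∈ T → ⊥

record Instance (n : ℕ) : Set₁ where
  field
    cap      : Fin n → ℕ
    cap≥1    : ∀ η → 1 ≤ cap η
    IsEdge   : Edge n → Set
    edge-nonempty : ∀ e → IsEdge e → Nonempty (Rd e)
    edge-cap : ∀ e → IsEdge e → ∣ Rd e ∣ ≤ cap (D e)
    closed   : ∀ η S S′ → IsEdge (η , S) → Nonempty S′ → S′ ⊆ S → IsEdge (η , S′)

module _ {n : ℕ} (I : Instance n) where
  open Instance I

  Free : List (Edge n) → Edge n → Set
  Free M e = All (λ e′ → D e′ ≢ D e) M × All (λ e′ → Disjoint (Rd e′) (Rd e)) M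

  Covers : List (Edge n) → Set
  Covers M = ∀ r → Any (λ e → r ∈ Rd e) M

  PairwiseDisjoint : List (Edge n) → Set
  PairwiseDisjoint = AllPairs (λ e e′ → D e ≢ D e′ × Disjoint (Rd e) (Rd e′))

  Feasible : List (Edge n) → Set
  Feasible M = All IsEdge M × PairwiseDisjoint M × Covers M

  Optimal : List (Edge n) → Set
  Optimal M = Feasible M × (∀ M′ → Feasible M′ → length M ≤ length M′)

  -- Possible partial runs of GreedyMinNum (most recently selected edge first).
  -- An edge of the current hypergraph is an edge of H vertex-disjoint from
  -- all edges selected so far; ties are broken arbitrarily.
  data GreedyRun : List (Edge n) → Set where
    start : GreedyRun []
    step  : ∀ {M} e → GreedyRun M → ¬ Covers M →
            IsEdge e → Free M e →
            (∀ e′ → IsEdge e′ → Free M e′ → ∣ Rd e′ ∣ ≤ ∣ Rd e ∣) →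
            GreedyRun (e ∷ M)

  GreedyOutput : List (Edge n) → Set
  GreedyOutput M = GreedyRun M × Covers M

-- Give every edge i of the optimal solution M* the weight "number of its riders
-- not yet covered by greedy", capped at 2 while the driver of i is still unused.
-- A greedy step with an edge of size t lowers the total weight by at least 2 − t:
-- if t ≥ 2, only the one edge of M* sharing the driver can gain, and by maximality
-- it gains at most t − 2; if t = 1, maximality leaves every edge of M* with an unused
-- driver at most one uncovered rider, so no cap is active and the covered rider is
-- lost by some edge of M*.
-- Starting from total weight at most 2|M*|, this gives 2|M| ≤ n + 2|M*|, and
-- n ≤ λ|M*| because M* covers all n riders.
module Submission where

open import Defs
open import Data.Nat using (ℕ; suc; _≤_; _<_; _*_; _+_; _⊓_; z≤n; s≤s)
open import Data.Nat.Properties hiding (_≟_)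
open import Data.Nat.ListAction using (sum)
open import Algebra.Properties.CommutativeSemigroup +-commutativeSemigroup using (xy∙z≈xz∙y; xy∙z≈zx∙y)
open import Data.Fin using (Fin; _≟_)
open import Data.Fin.Subset
  using (Subset; ∣_∣; _∈_; _∉_; _⊆_; _∪_; _∩_; _─_; ⋃; ⊤; ⁅_⁆; Empty; inside; outside)
open import Data.Fin.Subset.Properties
  using ( x∈p∪q⁻; p⊆p∪q; q⊆p∪q; x∈p∩q⁺; p∩q⊆p; p∩q⊆q; p─q─r≡p─q∪r; p─q─r≡p─r─q; x∈p∧x∉q⇒x∈p─q
        ; p─q⊆p; ∣p─q∣≤∣p∣; p∩q≢∅⇒∣p─q∣<∣p∣; p⊆q⇒∣p∣≤∣q∣; ∣⊤∣≡n; ∣⊥∣≡0; ∣p∣≤n; nonempty?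
        ; Empty-unique; ∉⊥)
open import Data.Vec.Base using ([]; _∷_; here; there)
open import Data.Product using (Σ; _×_; _,_; proj₁; proj₂)
open import Data.Sum using (inj₁; inj₂)
open import Data.List using (List; []; _∷_; map; length)
open import Data.List.Properties using (length-map)
open import Data.List.Relation.Unary.All as All using (All; []; _∷_)
open import Data.List.Relation.Unary.All.Properties using (¬Any⇒All¬; All¬⇒¬Any)
import Data.List.Relation.Unary.All.Properties as All
open import Data.List.Relation.Unary.Any as Any using (Any; here; there; any?)
import Data.List.Relation.Unary.Any.Properties as Any
open import Data.List.Relation.Unary.AllPairs using ([]; _∷_)
open import Relation.Binary.PropositionalEquality
  using (_≡_; _≢_; refl; sym; trans; cong; subst; subst₂; module ≡-Reasoning)
open import Relation.Nullary using (¬_; Dec; yes; no; contradiction)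
open import Function using (_∘_)

private
  variable
    m : ℕ

∣p∪q∣+∣p∩q∣≡∣p∣+∣q∣ : ∀ (p q : Subset m) → ∣ p ∪ q ∣ + ∣ p ∩ q ∣ ≡ ∣ p ∣ + ∣ q ∣
∣p∪q∣+∣p∩q∣≡∣p∣+∣q∣ []            []            = refl
∣p∪q∣+∣p∩q∣≡∣p∣+∣q∣ (inside  ∷ p) (inside  ∷ q) =
  cong suc (trans (+-suc _ _) (trans (cong suc (∣p∪q∣+∣p∩q∣≡∣p∣+∣q∣ p q)) (sym (+-suc _ _))))
∣p∪q∣+∣p∩q∣≡∣p∣+∣q∣ (inside  ∷ p) (outside ∷ q) = cong suc (∣p∪q∣+∣p∩q∣≡∣p∣+∣q∣ p q)
∣p∪q∣+∣p∩q∣≡∣p∣+∣q∣ (outside ∷ p) (inside  ∷ q) =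
  trans (cong suc (∣p∪q∣+∣p∩q∣≡∣p∣+∣q∣ p q)) (sym (+-suc _ _))
∣p∪q∣+∣p∩q∣≡∣p∣+∣q∣ (outside ∷ p) (outside ∷ q) = ∣p∪q∣+∣p∩q∣≡∣p∣+∣q∣ p q

∣p∪q∣≤∣p∣+∣q∣ : ∀ (p q : Subset m) → ∣ p ∪ q ∣ ≤ ∣ p ∣ + ∣ q ∣
∣p∪q∣≤∣p∣+∣q∣ p q = ≤-trans (m≤m+n _ _) (≤-reflexive (∣p∪q∣+∣p∩q∣≡∣p∣+∣q∣ p q))

Empty⇒∣p∣≡0 : ∀ {p : Subset m} → Empty p → ∣ p ∣ ≡ 0
Empty⇒∣p∣≡0 {m} empty = trans (cong ∣_∣ (Empty-unique empty)) (∣⊥∣≡0 m)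

∣p∪q∣≡∣p∣+∣q∣ : ∀ (p q : Subset m) → Disjoint p q → ∣ p ∪ q ∣ ≡ ∣ p ∣ + ∣ q ∣
∣p∪q∣≡∣p∣+∣q∣ p q disjoint = begin
  ∣ p ∪ q ∣             ≡⟨ +-identityʳ _ ⟨
  ∣ p ∪ q ∣ + 0         ≡⟨ cong (∣ p ∪ q ∣ +_) (Empty⇒∣p∣≡0 p∩q-empty) ⟨
  ∣ p ∪ q ∣ + ∣ p ∩ q ∣ ≡⟨ ∣p∪q∣+∣p∩q∣≡∣p∣+∣q∣ p q ⟩
  ∣ p ∣ + ∣ q ∣         ∎
  where
  open ≡-Reasoning
  p∩q-empty : Empty (p ∩ q)
  p∩q-empty (x , x∈p∩q) = disjoint x (p∩q⊆p p q x∈p∩q) (p∩q⊆q p q x∈p∩q)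

x∈p─q⇒x∉q : ∀ {x} (p q : Subset m) → x ∈ p ─ q → x ∉ q
x∈p─q⇒x∉q (_ ∷ p) (outside ∷ q) (there x∈p─q) (there x∈q) = x∈p─q⇒x∉q p q x∈p─q x∈q
x∈p─q⇒x∉q (_ ∷ p) (inside  ∷ q) (there x∈p─q) (there x∈q) = x∈p─q⇒x∉q p q x∈p─q x∈q

x∈p⇒0<∣p∣ : ∀ {x} {p : Subset m} → x ∈ p → 0 < ∣ p ∣
x∈p⇒0<∣p∣                        here        = s≤s z≤n
x∈p⇒0<∣p∣ {p = inside  ∷ _}     (there _)   = s≤s z≤n
x∈p⇒0<∣p∣ {p = outside ∷ _}     (there x∈p) = x∈p⇒0<∣p∣ x∈p

x∈⋃⁺ : ∀ {x} {ps : List (Subset m)} → Any (x ∈_) ps → x ∈ ⋃ ps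
x∈⋃⁺ {ps = p ∷ ps} (here x∈p)   = p⊆p∪q (⋃ ps) x∈p
x∈⋃⁺ {ps = p ∷ ps} (there x∈ps) = q⊆p∪q p (⋃ ps) (x∈⋃⁺ x∈ps)

∣⋃ps∣≤sum∣ps∣ : ∀ (ps : List (Subset m)) → ∣ ⋃ ps ∣ ≤ sum (map ∣_∣ ps)
∣⋃ps∣≤sum∣ps∣ {m} []       = ≤-reflexive (∣⊥∣≡0 m)
∣⋃ps∣≤sum∣ps∣     (p ∷ ps) = ≤-trans (∣p∪q∣≤∣p∣+∣q∣ p (⋃ ps)) (+-monoʳ-≤ ∣ p ∣ (∣⋃ps∣≤sum∣ps∣ ps))

Disjoint-⋃⁺ : ∀ {ps : List (Subset m)} {s} → All (λ p → Disjoint p s) ps → Disjoint (⋃ ps) s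
Disjoint-⋃⁺ {ps = []}     []       x x∈⊥ _ = ∉⊥ x∈⊥
Disjoint-⋃⁺ {ps = p ∷ ps} (d ∷ ds) x x∈p∪ps x∈s with x∈p∪q⁻ p (⋃ ps) x∈p∪ps
... | inj₁ x∈p  = d x x∈p x∈s
... | inj₂ x∈ps = Disjoint-⋃⁺ ds x x∈ps x∈s

Disjoint-⋃⁻ : ∀ (ps : List (Subset m)) {s} → Disjoint (⋃ ps) s → All (λ p → Disjoint p s) ps
Disjoint-⋃⁻ []       d = []
Disjoint-⋃⁻ (p ∷ ps) d =
  (λ x x∈p → d x (p⊆p∪q (⋃ ps) x∈p)) ∷ Disjoint-⋃⁻ ps (λ x x∈ps → d x (q⊆p∪q p (⋃ ps) x∈ps))

module _ {A : Set} {f g : A → ℕ} where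

  sum-map-mono : ∀ {xs} → All (λ x → f x ≤ g x) xs → sum (map f xs) ≤ sum (map g xs)
  sum-map-mono []         = z≤n
  sum-map-mono (le ∷ les) = +-mono-≤ le (sum-map-mono les)

  sum-map-mono-< : ∀ {Q : A → Set} {xs} → All (λ x → f x ≤ g x) xs → All (λ x → Q x → f x < g x) xs →
                   Any Q xs → sum (map f xs) < sum (map g xs)
  sum-map-mono-< (_  ∷ les) (lt ∷ _)   (here q)  = +-mono-<-≤ (lt q) (sum-map-mono les)
  sum-map-mono-< (le ∷ les) (_  ∷ lts) (there q) = +-mono-≤-< le (sum-map-mono-< les lts q)

sum-map-≤-const : ∀ {A : Set} {f : A → ℕ} c {xs} → All (λ x → f x ≤ c) xs → sum (map f xs) ≤ c * length xs
sum-map-≤-const c []                  = z≤n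
sum-map-≤-const c {_ ∷ xs} (le ∷ les) =
  ≤-trans (+-mono-≤ le (sum-map-≤-const c les)) (≤-reflexive (sym (*-suc c (length xs))))

m≤n≤o⇒m+2≤n⊓2+o : ∀ {m n o} → m ≤ n → n ≤ o → 2 ≤ o → m + 2 ≤ n ⊓ 2 + o
m≤n≤o⇒m+2≤n⊓2+o {m} {n} {o} m≤n n≤o 2≤o with n ≤? 2
... | yes n≤2 = subst (λ k → m + 2 ≤ k + o) (sym (m≤n⇒m⊓n≡m n≤2)) (+-mono-≤ m≤n 2≤o)
... | no  n≰2 = subst (λ k → m + 2 ≤ k + o) (sym (m≥n⇒m⊓n≡n (≰⇒≥ n≰2)))
                      (≤-trans (+-monoˡ-≤ 2 (≤-trans m≤n n≤o)) (≤-reflexive (+-comm o 2)))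

module _ {n : ℕ} where

  covered : List (Edge n) → Subset n
  covered M = ⋃ (map Rd M)

  riders : List (Edge n) → ℕ
  riders M = sum (map ∣_∣ (map Rd M))

  leftover : List (Edge n) → Edge n → Subset n
  leftover M i = Rd i ─ covered M

  DriverUsed : List (Edge n) → Fin n → Set
  DriverUsed M η = Any (λ e → D e ≡ η) M

  weight : List (Edge n) → Edge n → ℕ
  weight M i with any? (λ e → D e ≟ D i) M
  ... | yes _ = ∣ leftover M i ∣
  ... | no  _ = ∣ leftover M i ∣ ⊓ 2

  potential : List (Edge n) → List (Edge n) → ℕ
  potential M L = sum (map (weight M) L)

  leftover-∷ : ∀ e M i → leftover (e ∷ M) i ≡ leftover M i ─ Rd e
  leftover-∷ e M i =
    trans (sym (p─q─r≡p─q∪r (Rd i) (Rd e) (covered M))) (p─q─r≡p─r─q (Rd i) (Rd e) (covered M))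

  ∣leftover-∷∣≤∣leftover∣ : ∀ e M i → ∣ leftover (e ∷ M) i ∣ ≤ ∣ leftover M i ∣
  ∣leftover-∷∣≤∣leftover∣ e M i rewrite leftover-∷ e M i = ∣p─q∣≤∣p∣ (leftover M i) (Rd e)

  weight≤∣leftover∣ : ∀ M i → weight M i ≤ ∣ leftover M i ∣
  weight≤∣leftover∣ M i with any? (λ e → D e ≟ D i) M
  ... | yes _ = ≤-refl
  ... | no  _ = m⊓n≤m _ 2

  weight-used : ∀ {M i} → DriverUsed M (D i) → weight M i ≡ ∣ leftover M i ∣
  weight-used {M} {i} used with any? (λ e → D e ≟ D i) M
  ... | yes _      = refl
  ... | no  unused = contradiction used unused

  weight-unused : ∀ {M i} → ¬ DriverUsed M (D i) → weight M i ≡ ∣ leftover M i ∣ ⊓ 2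
  weight-unused {M} {i} unused with any? (λ e → D e ≟ D i) M
  ... | yes used = contradiction used unused
  ... | no  _    = refl

  weight-antitone : ∀ {e M i} → D e ≢ D i → weight (e ∷ M) i ≤ weight M i
  weight-antitone {e} {M} {i} De≢Di = by-cases (any? (λ e′ → D e′ ≟ D i) M)
    where
    unused′ : ¬ DriverUsed M (D i) → ¬ DriverUsed (e ∷ M) (D i)
    unused′ _      (here De≡Di) = De≢Di De≡Di
    unused′ unused (there used) = unused used

    by-cases : Dec (DriverUsed M (D i)) → weight (e ∷ M) i ≤ weight M i
    by-cases (yes used)   = subst₂ _≤_ (sym (weight-used {e ∷ M} {i} (there used)))
                                   (sym (weight-used {M} {i} used))
                                   (∣leftover-∷∣≤∣leftover∣ e M i)
    by-cases (no  unused) = subst₂ _≤_ (sym (weight-unused {e ∷ M} {i} (unused′ unused)))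
                                   (sym (weight-unused {M} {i} unused))
                                   (⊓-monoˡ-≤ 2 (∣leftover-∷∣≤∣leftover∣ e M i))

  potential-[]≤2*length : ∀ L → potential [] L ≤ 2 * length L
  potential-[]≤2*length L = sum-map-≤-const 2 (All.universal (λ i → m⊓n≤n _ 2) L)

module _ {n : ℕ} (I : Instance n) where
  open Instance I

  ⊤⊆covered : ∀ {L} → Covers I L → ⊤ ⊆ covered L
  ⊤⊆covered covers {r} _ = x∈⋃⁺ (Any.map⁺ (covers r))

  Free⇒Disjoint-covered : ∀ {M e} → Free I M e → Disjoint (Rd e) (covered M)
  Free⇒Disjoint-covered (_ , disjoint) r r∈e r∈M = Disjoint-⋃⁺ (All.map⁺ disjoint) r r∈M r∈e

  riders≡∣covered∣ : ∀ {M} → GreedyRun I M → riders M ≡ ∣ covered M ∣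
  riders≡∣covered∣ start = sym (∣⊥∣≡0 n)
  riders≡∣covered∣ (step {M} e run _ _ e-free _) = begin
    ∣ Rd e ∣ + riders M                ≡⟨ cong (∣ Rd e ∣ +_) (riders≡∣covered∣ run) ⟩
    ∣ Rd e ∣ + ∣ covered M ∣           ≡⟨ ∣p∪q∣≡∣p∣+∣q∣ (Rd e) (covered M) (Free⇒Disjoint-covered e-free) ⟨
    ∣ Rd e ∪ covered M ∣               ∎
    where open ≡-Reasoning

  module GreedyStep {e M} (e-edge : IsEdge e) (e-free : Free I M e)
                    (e-maximal : ∀ e′ → IsEdge e′ → Free I M e′ → ∣ Rd e′ ∣ ≤ ∣ Rd e ∣) where

    ∣leftover∣≤∣e∣ : ∀ {i} → IsEdge i → ¬ DriverUsed M (D i) → ∣ leftover M i ∣ ≤ ∣ Rd e ∣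
    ∣leftover∣≤∣e∣ {i} i-edge unused with nonempty? (leftover M i)
    ... | yes nonempty = e-maximal (D i , leftover M i) leftover-edge (¬Any⇒All¬ M unused , leftover-disjoint)
      where
      leftover-edge : IsEdge (D i , leftover M i)
      leftover-edge = closed (D i) (Rd i) (leftover M i) i-edge nonempty (p─q⊆p (Rd i) (covered M))
      leftover-disjoint : All (λ e′ → Disjoint (Rd e′) (leftover M i)) M
      leftover-disjoint = All.map⁻ (Disjoint-⋃⁻ (map Rd M) λ r r∈M r∈leftover →
                                      x∈p─q⇒x∉q (Rd i) (covered M) r∈leftover r∈M)
    ... | no  empty    = subst (_≤ ∣ Rd e ∣) (sym (Empty⇒∣p∣≡0 empty)) z≤n

    ∣leftover-∷∣<∣leftover∣ : ∀ {i r} → r ∈ Rd e → r ∈ Rd i → ∣ leftover (e ∷ M) i ∣ < ∣ leftover M i ∣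
    ∣leftover-∷∣<∣leftover∣ {i} {r} r∈e r∈i rewrite leftover-∷ e M i =
      p∩q≢∅⇒∣p─q∣<∣p∣ (leftover M i) (Rd e) (r , x∈p∩q⁺ (x∈p∧x∉q⇒x∈p─q r∈i r∉M , r∈e))
      where
      r∉M : r ∉ covered M
      r∉M = Free⇒Disjoint-covered e-free r r∈e

    shared-driver-step : 2 ≤ ∣ Rd e ∣ → ∀ {i} → IsEdge i → D i ≡ D e →
                         weight (e ∷ M) i + 2 ≤ weight M i + ∣ Rd e ∣
    shared-driver-step 2≤e {i} i-edge Di≡De =
      subst₂ (λ w′ w → w′ + 2 ≤ w + ∣ Rd e ∣)
             (sym (weight-used {M = e ∷ M} {i = i} (here (sym Di≡De))))
             (sym (weight-unused {M = M} {i = i} unused))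
             (m≤n≤o⇒m+2≤n⊓2+o (∣leftover-∷∣≤∣leftover∣ e M i) (∣leftover∣≤∣e∣ i-edge unused) 2≤e)
      where
      unused : ¬ DriverUsed M (D i)
      unused = subst (¬_ ∘ DriverUsed M) (sym Di≡De) (All¬⇒¬Any (proj₁ e-free))

    potential-step-large : 2 ≤ ∣ Rd e ∣ → ∀ {L} → All IsEdge L → PairwiseDisjoint I L →
                           potential (e ∷ M) L + 2 ≤ potential M L + ∣ Rd e ∣
    potential-step-large 2≤e []                []                  = 2≤e
    potential-step-large 2≤e {i ∷ L} (i-edge ∷ edges) (i-apart ∷ apart) with D i ≟ D e
    ... | yes Di≡De = begin
      (weight (e ∷ M) i + potential (e ∷ M) L) + 2   ≡⟨ xy∙z≈xz∙y (weight (e ∷ M) i) (potential (e ∷ M) L) 2 ⟩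
      (weight (e ∷ M) i + 2) + potential (e ∷ M) L   ≤⟨ +-mono-≤ (shared-driver-step 2≤e i-edge Di≡De)
                                                          (sum-map-mono (All.map others-antitone i-apart)) ⟩
      (weight M i + ∣ Rd e ∣) + potential M L        ≡⟨ xy∙z≈xz∙y (weight M i) ∣ Rd e ∣ (potential M L) ⟩
      (weight M i + potential M L) + ∣ Rd e ∣        ∎
      where
      open ≤-Reasoning
      others-antitone : ∀ {j} → D i ≢ D j × Disjoint (Rd i) (Rd j) → weight (e ∷ M) j ≤ weight M j
      others-antitone (Di≢Dj , _) = weight-antitone (Di≢Dj ∘ trans Di≡De)
    ... | no  Di≢De = begin
      (weight (e ∷ M) i + potential (e ∷ M) L) + 2   ≡⟨ +-assoc (weight (e ∷ M) i) (potential (e ∷ M) L) 2 ⟩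
      weight (e ∷ M) i + (potential (e ∷ M) L + 2)   ≤⟨ +-mono-≤ (weight-antitone (Di≢De ∘ sym))
                                                          (potential-step-large 2≤e edges apart) ⟩
      weight M i + (potential M L + ∣ Rd e ∣)        ≡⟨ +-assoc (weight M i) (potential M L) ∣ Rd e ∣ ⟨
      (weight M i + potential M L) + ∣ Rd e ∣        ∎
      where open ≤-Reasoning

    potential-step-small : ∣ Rd e ∣ ≤ 1 → ∀ {L} → All IsEdge L → Covers I L →
                           potential (e ∷ M) L < potential M L
    potential-step-small e≤1 edges covers =
      sum-map-mono-< (All.map weight-∷≤ edges) (All.map weight-∷< edges) (covers r)
      where
      r = proj₁ (edge-nonempty e e-edge)
      r∈e = proj₂ (edge-nonempty e e-edge)

      weight≡∣leftover∣ : ∀ {i} → IsEdge i → weight M i ≡ ∣ leftover M i ∣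
      weight≡∣leftover∣ {i} i-edge with any? (λ e′ → D e′ ≟ D i) M
      ... | yes _      = refl
      ... | no  unused = m≤n⇒m⊓n≡m (≤-trans (∣leftover∣≤∣e∣ i-edge unused) (m≤n⇒m≤1+n e≤1))

      weight-∷≤ : ∀ {i} → IsEdge i → weight (e ∷ M) i ≤ weight M i
      weight-∷≤ {i} i-edge = begin
        weight (e ∷ M) i        ≤⟨ weight≤∣leftover∣ (e ∷ M) i ⟩
        ∣ leftover (e ∷ M) i ∣  ≤⟨ ∣leftover-∷∣≤∣leftover∣ e M i ⟩
        ∣ leftover M i ∣        ≡⟨ weight≡∣leftover∣ i-edge ⟨
        weight M i              ∎
        where open ≤-Reasoning

      weight-∷< : ∀ {i} → IsEdge i → r ∈ Rd i → weight (e ∷ M) i < weight M i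
      weight-∷< {i} i-edge r∈i = begin-strict
        weight (e ∷ M) i        ≤⟨ weight≤∣leftover∣ (e ∷ M) i ⟩
        ∣ leftover (e ∷ M) i ∣  <⟨ ∣leftover-∷∣<∣leftover∣ {i} r∈e r∈i ⟩
        ∣ leftover M i ∣        ≡⟨ weight≡∣leftover∣ i-edge ⟨
        weight M i              ∎
        where open ≤-Reasoning

    potential-step : ∀ {L} → All IsEdge L → PairwiseDisjoint I L → Covers I L →
                     potential (e ∷ M) L + 2 ≤ potential M L + ∣ Rd e ∣
    potential-step {L} edges apart covers with 2 ≤? ∣ Rd e ∣
    ... | yes 2≤e = potential-step-large 2≤e edges apart
    ... | no  2≰e = begin
      potential (e ∷ M) L + 2        ≡⟨ +-suc (potential (e ∷ M) L) 1 ⟩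
      suc (potential (e ∷ M) L) + 1  ≤⟨ +-mono-≤ (potential-step-small (≤-pred (≰⇒> 2≰e)) edges covers)
                                                  (x∈p⇒0<∣p∣ (proj₂ (edge-nonempty e e-edge))) ⟩
      potential M L + ∣ Rd e ∣       ∎
      where open ≤-Reasoning

  potential-invariant : ∀ {L} → All IsEdge L → PairwiseDisjoint I L → Covers I L →
                        ∀ {M} → GreedyRun I M → potential M L + 2 * length M ≤ riders M + potential [] L
  potential-invariant {L} _     _     _      start = ≤-reflexive (+-identityʳ (potential [] L))
  potential-invariant {L} edges apart covers (step {M} e run _ e-edge e-free e-maximal) = begin
    potential (e ∷ M) L + 2 * suc (length M)    ≡⟨ cong (potential (e ∷ M) L +_) (*-suc 2 (length M)) ⟩
    potential (e ∷ M) L + (2 + 2 * length M)    ≡⟨ +-assoc (potential (e ∷ M) L) 2 (2 * length M) ⟨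
    (potential (e ∷ M) L + 2) + 2 * length M    ≤⟨ +-monoˡ-≤ (2 * length M) (potential-step edges apart covers) ⟩
    (potential M L + ∣ Rd e ∣) + 2 * length M   ≡⟨ xy∙z≈xz∙y (potential M L) ∣ Rd e ∣ (2 * length M) ⟩
    (potential M L + 2 * length M) + ∣ Rd e ∣   ≤⟨ +-monoˡ-≤ ∣ Rd e ∣ (potential-invariant edges apart covers run) ⟩
    (riders M + potential [] L) + ∣ Rd e ∣      ≡⟨ xy∙z≈zx∙y (riders M) (potential [] L) ∣ Rd e ∣ ⟩
    (∣ Rd e ∣ + riders M) + potential [] L      ∎
    where
    open ≤-Reasoning
    open GreedyStep e-edge e-free e-maximal

  riders≤riders-of-cover : ∀ {M L} → GreedyRun I M → Covers I L → riders M ≤ riders L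
  riders≤riders-of-cover {M} {L} run covers = begin
    riders M           ≡⟨ riders≡∣covered∣ run ⟩
    ∣ covered M ∣      ≤⟨ ∣p∣≤n (covered M) ⟩
    n                  ≡⟨ ∣⊤∣≡n n ⟨
    ∣ ⊤ {n} ∣          ≤⟨ p⊆q⇒∣p∣≤∣q∣ (⊤⊆covered covers) ⟩
    ∣ covered L ∣      ≤⟨ ∣⋃ps∣≤sum∣ps∣ (map Rd L) ⟩
    riders L           ∎
    where open ≤-Reasoning

  riders≤cap*length : ∀ {c} → (∀ η → cap η ≤ c) → ∀ {L} → All IsEdge L → riders L ≤ c * length L
  riders≤cap*length {c} cap≤c {L} edges =
    subst (λ k → riders L ≤ c * k) (length-map Rd L) (sum-map-≤-const c (All.map⁺ (All.map ∣e∣≤c edges)))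
    where
    ∣e∣≤c : ∀ {e} → IsEdge e → ∣ Rd e ∣ ≤ c
    ∣e∣≤c {e} e-edge = ≤-trans (edge-cap e e-edge) (cap≤c (D e))

theorem4 : ∀ (n : ℕ) (I : Instance n) (λmax : ℕ) →
    (∀ η r → Instance.IsEdge I (η , ⁅ r ⁆)) →
    (∀ η → Instance.cap I η ≤ λmax) → Σ (Fin n) (λ η → Instance.cap I η ≡ λmax) →
    2 ≤ λmax →
    ∀ M Mstar → GreedyOutput I M → Optimal I Mstar →
    2 * length M ≤ (λmax + 2) * length Mstar
theorem4 n I λmax _ cap≤λmax _ _ M Mstar (run , _) ((edges , apart , covers) , _) = begin
  2 * length M                                     ≤⟨ m≤n+m (2 * length M) (potential M Mstar) ⟩
  potential M Mstar + 2 * length M                 ≤⟨ potential-invariant I edges apart covers run ⟩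
  riders M + potential [] Mstar                    ≤⟨ +-mono-≤ riders-bound (potential-[]≤2*length Mstar) ⟩
  λmax * length Mstar + 2 * length Mstar           ≡⟨ *-distribʳ-+ (length Mstar) λmax 2 ⟨
  (λmax + 2) * length Mstar                        ∎
  where
  open ≤-Reasoning
  riders-bound : riders M ≤ λmax * length Mstar
  riders-bound = ≤-trans (riders≤riders-of-cover I run covers) (riders≤cap*length I cap≤λmax edges)
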